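{- Let $G=(V,E,w)$ be a directed graph with positive integer vertex weights and let $T\subseteq V$. Let $G'=(V',E',w')$ be the undirected graph with $V'=V_{\mathrm{out}}\cup V_{\mathrm{in}}$ (two disjoint copies $\{v_{\mathrm{out}}:v\in V\}$ and $\{v_{\mathrm{in}}:v\in V\}$ of $V$), whose edges are a clique on $V_{\mathrm{out}}$, a clique on $V_{\mathrm{in}}$, the edges $\{v_{\mathrm{out}},v_{\mathrm{in}}\}$ for $v\in V$, and the edges $\{u_{\mathrm{out}},v_{\mathrm{in}}\}$ for $(u,v)\in E$, with weights $w'(v_{\mathrm{out}})=w'(v_{\mathrm{in}})=w(v)$, and let $T'=\{t_{\mathrm{out}}:t\in T\}\cup\{t_{\mathrm{in}}:t\in T\}$. Then $\min_{s,t\in T}\kappa_G(s,t)=\min_{s',t'\in T'}\kappa_{G'}(s',t')-w(V)$.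
   Context: A vertex cut of a directed graph is a tripartition $(L,S,R)$ of the vertex set with $L,R$ nonempty and no edge $(u,v)$ with $u\in L$, $v\in R$; for an undirected graph, no edge between $L$ and $R$. Its weight is $w(S)=\sum_{v\in S}w(v)$. For vertices $s,t$ of a graph $H$, $\kappa_H(s,t)$ is the minimum weight of a vertex cut $(L,S,R)$ with $s\in L$ and $t\in R$, and is $\infty$ if no such cut exists (in particular if $s=t$ or $s,t$ are joined by an edge, for directed graphs an edge $(s,t)$). $w(V)=\sum_{v\in V}w(v)$. -}

module Defs where

open import Data.Nat using (ℕ; zero; suc; _+_; _⊓_)
open import Data.Fin using (Fin; zero; suc; splitAt; _↑ˡ_; _↑ʳ_; _≟_)
open import Data.Bool using (Bool; true; false; _∧_; _∨_; not)
open import Data.Sum using (inj₁; inj₂; [_,_]′)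
open import Data.List using (List; []; _∷_; map; concatMap; foldr; filterᵇ; allFin)
open import Data.Bool.ListAction using (any; all)
open import Data.Nat.ListAction using (sum)
open import Relation.Nullary using (does)

data ℕ∞ : Set where
  fin : ℕ → ℕ∞
  ∞   : ℕ∞

_⊓∞_ : ℕ∞ → ℕ∞ → ℕ∞
∞     ⊓∞ y     = y
fin a ⊓∞ ∞     = fin a
fin a ⊓∞ fin b = fin (a ⊓ b)

_+∞_ : ℕ∞ → ℕ → ℕ∞
fin a +∞ k = fin (a + k)
∞     +∞ k = ∞

min∞ : List ℕ∞ → ℕ∞
min∞ = foldr _⊓∞_ ∞

-- Tripartitions (L , S , R) of Fin m, given as labellings

data Part : Set where
  Lp Sp Rp : Part

isL isS isR : Part → Bool
isL Lp = true
isL _  = false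
isS Sp = true
isS _  = false
isR Rp = true
isR _  = false

consP : ∀ {m} → Part → (Fin m → Part) → Fin (suc m) → Part
consP p f zero    = p
consP p f (suc i) = f i

labellings : (m : ℕ) → List (Fin m → Part)
labellings zero    = (λ ()) ∷ []
labellings (suc m) =
  concatMap (λ f → map (λ p → consP p f) (Lp ∷ Sp ∷ Rp ∷ [])) (labellings m)

_==_ : ∀ {m} → Fin m → Fin m → Bool
u == v = does (u ≟ v)

weightOf : (m : ℕ) → (Fin m → ℕ) → (Fin m → Bool) → ℕ
weightOf m w X = sum (map w (filterᵇ X (allFin m)))

totalWeight : (m : ℕ) → (Fin m → ℕ) → ℕ
totalWeight m w = weightOf m w (λ _ → true)

LRnonempty : (m : ℕ) → (Fin m → Part) → Bool
LRnonempty m f = any (λ v → isL (f v)) (allFin m) ∧ any (λ v → isR (f v)) (allFin m)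

isDiCut : (m : ℕ) → (Fin m → Fin m → Bool) → (Fin m → Part) → Bool
isDiCut m E f = LRnonempty m f ∧
  all (λ u → all (λ v → not (isL (f u) ∧ isR (f v) ∧ E u v)) (allFin m)) (allFin m)

isUnCut : (m : ℕ) → (Fin m → Fin m → Bool) → (Fin m → Part) → Bool
isUnCut m A f = LRnonempty m f ∧
  all (λ u → all (λ v → not (isL (f u) ∧ isR (f v) ∧ (A u v ∨ A v u))) (allFin m)) (allFin m)

κ : (m : ℕ) → ((Fin m → Part) → Bool) → (Fin m → ℕ) → Fin m → Fin m → ℕ∞
κ m isCut w s t =
  min∞ (map (λ f → fin (weightOf m w (λ v → isS (f v))))
            (filterᵇ (λ f → isCut f ∧ isL (f s) ∧ isR (f t)) (labellings m)))

κDi : (m : ℕ) → (Fin m → Fin m → Bool) → (Fin m → ℕ) → Fin m → Fin m → ℕ∞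
κDi m E w = κ m (isDiCut m E) w

κUn : (m : ℕ) → (Fin m → Fin m → Bool) → (Fin m → ℕ) → Fin m → Fin m → ℕ∞
κUn m A w = κ m (isUnCut m A) w

minPairs : (m : ℕ) → (Fin m → Bool) → (Fin m → Fin m → ℕ∞) → ℕ∞
minPairs m T k =
  min∞ (concatMap (λ s → map (λ t → k s t) (filterᵇ T (allFin m))) (filterᵇ T (allFin m)))

-- The split graph G' on V' = V_out ∪ V_in = Fin (n + n)
-- v_out = v ↑ˡ n  (first copy),  v_in = n ↑ʳ v  (second copy)

vOut : ∀ {n} → Fin n → Fin (n + n)
vOut {n} v = v ↑ˡ n

vIn : ∀ {n} → Fin n → Fin (n + n)
vIn {n} v = n ↑ʳ v

splitAdj : (n : ℕ) → (Fin n → Fin n → Bool) → Fin (n + n) → Fin (n + n) → Bool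
splitAdj n E x y with splitAt n x | splitAt n y
... | inj₁ u | inj₁ v = not (u == v)
... | inj₂ u | inj₂ v = not (u == v)
... | inj₁ u | inj₂ v = (u == v) ∨ E u v
... | inj₂ u | inj₁ v = (u == v) ∨ E v u

splitWeight : (n : ℕ) → (Fin n → ℕ) → Fin (n + n) → ℕ
splitWeight n w x = [ w , w ]′ (splitAt n x)

splitTerm : (n : ℕ) → (Fin n → Bool) → Fin (n + n) → Bool
splitTerm n T x = [ T , T ]′ (splitAt n x)

{-# OPTIONS --safe #-}
module Submission where

-- A cut (L, S, R) of G separating s from t yields the cut (L_out, S', R_in) of G' separating
-- s_out from t_in, where S' holds all other vertices: a vertex outside S has exactly one copy
-- in S' and a vertex of S has both, so w'(S') = w(S) + w(V).  Conversely, the cliques on V_out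
-- and V_in force a cut of G' between two terminal copies to separate an out-copy s_out from an
-- in-copy t_in (after exchanging L' and R').  Then no out-copy lies in R', no in-copy in L', and
-- never both v_out ∈ L' and v_in ∈ R'; so every vertex has a copy in S', and
-- L = {v : v_out ∈ L'}, R = {v : v_in ∈ R'} is a cut of G of weight w'(S') − w(V).

open import Defs
open import Data.Nat using (ℕ; zero; suc; _+_; _<_; _≤_)
open import Data.Nat.Properties
  using (≤-refl; ≤-trans; ≤-antisym; ≤-reflexive; +-monoˡ-≤; m⊓n≤m; m⊓n≤n; ⊓-glb;
         +-distribʳ-⊓; +-identityʳ; +-assoc; +-0-commutativeMonoid)
open import Data.Nat.ListAction as List using ()
open import Data.Fin using (Fin; zero; suc; splitAt; _↑ˡ_; _↑ʳ_; _≟_)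
open import Data.Fin.Properties using (splitAt-↑ˡ; splitAt-↑ʳ; splitAt⁻¹-↑ˡ; splitAt⁻¹-↑ʳ)
open import Data.Bool using (Bool; true; false; T; if_then_else_; _∧_; _∨_; not)
open import Data.Bool.Properties using (T-∧; T-∨; ∨-comm)
open import Data.Sum as Sum using (_⊎_; inj₁; inj₂; [_,_]′)
open import Data.Product using (_×_; _,_; ∃-syntax)
open import Data.Empty using (⊥-elim)
open import Data.List using (List; []; _∷_; map; filterᵇ; tabulate; allFin)
open import Data.List.Membership.Propositional using (_∈_; find; lose)
open import Data.List.Membership.Propositional.Properties
  using (∈-map⁺; ∈-map⁻; ∈-concatMap⁺; ∈-concatMap⁻; ∈-filter⁺; ∈-filter⁻; ∈-allFin)
open import Data.Bool.ListAction using (any; all)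
open import Data.List.Relation.Unary.Any using (here; there)
open import Data.List.Relation.Unary.Any.Properties using (any⁺)
import Data.List.Relation.Unary.All as All
open import Data.List.Relation.Unary.All.Properties using (all⁺; all⁻)
open import Data.Vec.Functional using (_++_)
open import Data.Vec.Functional.Properties using (lookup-++ˡ; lookup-++ʳ)
open import Algebra.Properties.CommutativeMonoid.Sum +-0-commutativeMonoid
  using (sum-syntax; sum-cong-≗; ∑-distrib-+)
open import Function using (_∘_; id; _⇔_; Equivalence; mk⇔)
open import Relation.Nullary using (¬_; yes; no)
open import Relation.Nullary.Decidable using (T?; dec-true; dec-false)
open import Relation.Binary.PropositionalEquality
  using (_≡_; _≢_; _≗_; refl; sym; trans; cong; cong₂; subst; module ≡-Reasoning)

infix 4 _≤∞_

data _≤∞_ : ℕ∞ → ℕ∞ → Set where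
  fin≤fin : ∀ {a b} → a ≤ b → fin a ≤∞ fin b
  ≤∞-top  : ∀ {x} → x ≤∞ ∞

≤∞-refl : ∀ {x} → x ≤∞ x
≤∞-refl {fin a} = fin≤fin ≤-refl
≤∞-refl {∞}     = ≤∞-top

≤∞-trans : ∀ {x y z} → x ≤∞ y → y ≤∞ z → x ≤∞ z
≤∞-trans (fin≤fin p) (fin≤fin q) = fin≤fin (≤-trans p q)
≤∞-trans _           ≤∞-top      = ≤∞-top

≤∞-antisym : ∀ {x y} → x ≤∞ y → y ≤∞ x → x ≡ y
≤∞-antisym (fin≤fin p) (fin≤fin q) = cong fin (≤-antisym p q)
≤∞-antisym ≤∞-top      ≤∞-top      = refl

+∞-monoˡ-≤∞ : ∀ {x y} k → x ≤∞ y → x +∞ k ≤∞ y +∞ k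
+∞-monoˡ-≤∞ k (fin≤fin p) = fin≤fin (+-monoˡ-≤ k p)
+∞-monoˡ-≤∞ k ≤∞-top      = ≤∞-top

+∞-identityʳ : ∀ x → x +∞ 0 ≡ x
+∞-identityʳ (fin a) = cong fin (+-identityʳ a)
+∞-identityʳ ∞       = refl

⊓∞-≤ˡ : ∀ x y → x ⊓∞ y ≤∞ x
⊓∞-≤ˡ (fin a) (fin b) = fin≤fin (m⊓n≤m a b)
⊓∞-≤ˡ (fin a) ∞       = ≤∞-refl
⊓∞-≤ˡ ∞       y       = ≤∞-top

⊓∞-≤ʳ : ∀ x y → x ⊓∞ y ≤∞ y
⊓∞-≤ʳ (fin a) (fin b) = fin≤fin (m⊓n≤n a b)
⊓∞-≤ʳ (fin a) ∞       = ≤∞-top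
⊓∞-≤ʳ ∞       y       = ≤∞-refl

⊓∞-greatest-+∞ : ∀ {z} x y k → z ≤∞ x +∞ k → z ≤∞ y +∞ k → z ≤∞ (x ⊓∞ y) +∞ k
⊓∞-greatest-+∞ ∞       y       k _ q = q
⊓∞-greatest-+∞ (fin a) ∞       k p _ = p
⊓∞-greatest-+∞ (fin a) (fin b) k (fin≤fin p) (fin≤fin q) =
  fin≤fin (subst (_ ≤_) (sym (+-distribʳ-⊓ k a b)) (⊓-glb p q))

min∞-≤ : ∀ {x xs} → x ∈ xs → min∞ xs ≤∞ x
min∞-≤ {xs = x ∷ xs} (here refl) = ⊓∞-≤ˡ x (min∞ xs)
min∞-≤ {xs = y ∷ xs} (there x∈) = ≤∞-trans (⊓∞-≤ʳ y (min∞ xs)) (min∞-≤ x∈)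

min∞-greatest-+∞ : ∀ {z} xs k → (∀ {x} → x ∈ xs → z ≤∞ x +∞ k) → z ≤∞ min∞ xs +∞ k
min∞-greatest-+∞ []       k h = ≤∞-top
min∞-greatest-+∞ (x ∷ xs) k h =
  ⊓∞-greatest-+∞ x (min∞ xs) k (h (here refl)) (min∞-greatest-+∞ xs k (h ∘ there))

record Separates {m} (E : Fin m → Fin m → Bool) (f : Fin m → Part) (s t : Fin m) : Set where
  field
    source  : f s ≡ Lp
    sink    : f t ≡ Rp
    no-edge : ∀ {u v} → f u ≡ Lp → f v ≡ Rp → ¬ T (E u v)

  apart : ∀ {u v} → f u ≡ Lp → f v ≡ Rp → ¬ (u ≡ v ⊎ T (E u v))
  apart fu≡L fv≡R (inj₁ refl) with () ← trans (sym fu≡L) fv≡R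
  apart fu≡L fv≡R (inj₂ e)    = no-edge fu≡L fv≡R e

  ends-apart : ¬ (s ≡ t ⊎ T (E s t))
  ends-apart = apart source sink

Separates-cong : ∀ {m E f g} {s t : Fin m} → f ≗ g → Separates E f s t → Separates E g s t
Separates-cong f≗g sep = record
  { source  = trans (sym (f≗g _)) source
  ; sink    = trans (sym (f≗g _)) sink
  ; no-edge = λ gu≡L gv≡R → no-edge (trans (f≗g _) gu≡L) (trans (f≗g _) gv≡R)
  }
  where open Separates sep

mirror : Part → Part
mirror Lp = Rp
mirror Sp = Sp
mirror Rp = Lp

mirror-Lp⁻ : ∀ {p} → mirror p ≡ Lp → p ≡ Rp
mirror-Lp⁻ {Rp} _ = refl

mirror-Rp⁻ : ∀ {p} → mirror p ≡ Rp → p ≡ Lp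
mirror-Rp⁻ {Lp} _ = refl

isS-mirror : ∀ p → isS (mirror p) ≡ isS p
isS-mirror Lp = refl
isS-mirror Sp = refl
isS-mirror Rp = refl

Separates-mirror : ∀ {m E f} {s t : Fin m} → (∀ {u v} → T (E u v) → T (E v u)) →
                   Separates E f s t → Separates E (mirror ∘ f) t s
Separates-mirror E-sym sep = record
  { source  = cong mirror sink
  ; sink    = cong mirror source
  ; no-edge = λ fu≡L fv≡R e → no-edge (mirror-Rp⁻ fv≡R) (mirror-Lp⁻ fu≡L) (E-sym e)
  }
  where open Separates sep

isL⇒≡Lp : ∀ {p} → T (isL p) → p ≡ Lp
isL⇒≡Lp {Lp} _ = refl

isR⇒≡Rp : ∀ {p} → T (isR p) → p ≡ Rp
isR⇒≡Rp {Rp} _ = refl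

≡Lp⇒isL : ∀ {p} → p ≡ Lp → T (isL p)
≡Lp⇒isL refl = _

≡Rp⇒isR : ∀ {p} → p ≡ Rp → T (isR p)
≡Rp⇒isR refl = _

no-L-R-edge⁻ : ∀ {p q b} → T (not (isL p ∧ isR q ∧ b)) → p ≡ Lp → q ≡ Rp → ¬ T b
no-L-R-edge⁻ {b = false} _ refl refl ()

no-L-R-edge⁺ : ∀ p q b → (p ≡ Lp → q ≡ Rp → ¬ T b) → T (not (isL p ∧ isR q ∧ b))
no-L-R-edge⁺ Lp Rp true  h = h refl refl _
no-L-R-edge⁺ Lp Rp false h = _
no-L-R-edge⁺ Lp Lp b     h = _
no-L-R-edge⁺ Lp Sp b     h = _
no-L-R-edge⁺ Sp q  b     h = _
no-L-R-edge⁺ Rp q  b     h = _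

isDiCut⇒Separates : ∀ {m E f} {s t : Fin m} →
                    T (isDiCut m E f ∧ isL (f s) ∧ isR (f t)) → Separates E f s t
isDiCut⇒Separates {m} {E} {f} {s} {t} h =
  let cut , ends = Equivalence.to (T-∧ {isDiCut m E f}) h
      s∈L , t∈R  = Equivalence.to (T-∧ {isL (f s)}) ends
      _ , no-L-R = Equivalence.to (T-∧ {LRnonempty m f}) cut
      no-L-R-from u = all⁺ _ _ (All.lookup (all⁺ _ _ no-L-R) (∈-allFin u))
  in record
    { source  = isL⇒≡Lp s∈L
    ; sink    = isR⇒≡Rp t∈R
    ; no-edge = λ {u} {v} → no-L-R-edge⁻ (All.lookup (no-L-R-from u) (∈-allFin v))
    }

Separates⇒isDiCut : ∀ {m E f} {s t : Fin m} →
                    Separates E f s t → T (isDiCut m E f ∧ isL (f s) ∧ isR (f t))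
Separates⇒isDiCut {m} {E} {f} {s} {t} sep =
  ∧-intro (∧-intro (∧-intro L-nonempty R-nonempty) no-L-R) (∧-intro (≡Lp⇒isL source) (≡Rp⇒isR sink))
  where
  open Separates sep
  ∧-intro : ∀ {a b} → T a → T b → T (a ∧ b)
  ∧-intro ta tb = Equivalence.from T-∧ (ta , tb)
  L-nonempty : T (any (λ v → isL (f v)) (allFin m))
  L-nonempty = any⁺ _ (lose (∈-allFin s) (≡Lp⇒isL source))
  R-nonempty : T (any (λ v → isR (f v)) (allFin m))
  R-nonempty = any⁺ _ (lose (∈-allFin t) (≡Rp⇒isR sink))
  no-L-R : T (all (λ u → all (λ v → not (isL (f u) ∧ isR (f v) ∧ E u v)) (allFin m)) (allFin m))
  no-L-R = all⁻ _ (All.universal (λ u → all⁻ _ (All.universal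
             (λ v → no-L-R-edge⁺ (f u) (f v) (E u v) no-edge) (allFin m))) (allFin m))

sWeight : Part → ℕ → ℕ
sWeight p a = if isS p then a else 0

cutWeight : (m : ℕ) → (Fin m → ℕ) → (Fin m → Part) → ℕ
cutWeight m w f = weightOf m w (λ v → isS (f v))

filter-weight-∑ : ∀ {k} m (g : Fin m → Fin k) (w : Fin k → ℕ) (X : Fin k → Bool) →
                  List.sum (map w (filterᵇ X (tabulate g))) ≡ ∑[ i < m ] (if X (g i) then w (g i) else 0)
filter-weight-∑ zero    g w X = refl
filter-weight-∑ (suc m) g w X with X (g zero)
... | true  = cong (w (g zero) +_) (filter-weight-∑ m (g ∘ suc) w X)
... | false = filter-weight-∑ m (g ∘ suc) w X

weightOf-∑ : ∀ m (w : Fin m → ℕ) (X : Fin m → Bool) →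
             weightOf m w X ≡ ∑[ i < m ] (if X i then w i else 0)
weightOf-∑ m = filter-weight-∑ m id

cutWeight-∑ : ∀ m (w : Fin m → ℕ) (f : Fin m → Part) → cutWeight m w f ≡ ∑[ i < m ] sWeight (f i) (w i)
cutWeight-∑ m w f = weightOf-∑ m w (λ v → isS (f v))

totalWeight-∑ : ∀ m (w : Fin m → ℕ) → totalWeight m w ≡ ∑[ i < m ] w i
totalWeight-∑ m w = weightOf-∑ m w (λ _ → true)

weightOf-cong : ∀ m (w : Fin m → ℕ) {X Y : Fin m → Bool} → X ≗ Y → weightOf m w X ≡ weightOf m w Y
weightOf-cong m w {X} {Y} X≗Y = begin
  weightOf m w X                          ≡⟨ weightOf-∑ m w X ⟩
  ∑[ i < m ] (if X i then w i else 0)     ≡⟨ sum-cong-≗ (λ i → cong (if_then w i else 0) (X≗Y i)) ⟩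
  ∑[ i < m ] (if Y i then w i else 0)     ≡⟨ weightOf-∑ m w Y ⟨
  weightOf m w Y                          ∎
  where open ≡-Reasoning

cutWeight-mirror : ∀ m (w : Fin m → ℕ) (f : Fin m → Part) → cutWeight m w (mirror ∘ f) ≡ cutWeight m w f
cutWeight-mirror m w f = weightOf-cong m w (isS-mirror ∘ f)

∑-↑ : ∀ a b (g : Fin (a + b) → ℕ) → ∑[ i < a + b ] g i ≡ ∑[ i < a ] g (i ↑ˡ b) + ∑[ j < b ] g (a ↑ʳ j)
∑-↑ zero    b g = refl
∑-↑ (suc a) b g = trans (cong (g zero +_) (∑-↑ a b (g ∘ suc))) (sym (+-assoc (g zero) _ _))

labellings-complete : ∀ m (f : Fin m → Part) → ∃[ g ] g ∈ labellings m × g ≗ f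
labellings-complete zero    f = (λ ()) , here refl , λ ()
labellings-complete (suc m) f =
  let g , g∈ , g≗f = labellings-complete m (f ∘ suc)
  in consP (f zero) g ,
     ∈-concatMap⁺ (λ h → map (λ p → consP p h) (Lp ∷ Sp ∷ Rp ∷ []))
                  (lose g∈ (∈-map⁺ (λ p → consP p g) (part∈ (f zero)))) ,
     λ { zero → refl ; (suc i) → g≗f i }
  where
  part∈ : ∀ p → p ∈ Lp ∷ Sp ∷ Rp ∷ []
  part∈ Lp = here refl
  part∈ Sp = there (here refl)
  part∈ Rp = there (there (here refl))

module _ {m : ℕ} (E : Fin m → Fin m → Bool) (w : Fin m → ℕ) {s t : Fin m} where

  private
    separating : (Fin m → Part) → Bool
    separating f = isDiCut m E f ∧ isL (f s) ∧ isR (f t)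

    weight : (Fin m → Part) → ℕ∞
    weight f = fin (cutWeight m w f)

  κDi-≤ : ∀ {f} → Separates E f s t → κDi m E w s t ≤∞ fin (cutWeight m w f)
  κDi-≤ {f} sep =
    let g , g∈ , g≗f = labellings-complete m f
        g-separates  = Separates⇒isDiCut (Separates-cong (sym ∘ g≗f) sep)
        weight∈      = ∈-map⁺ weight (∈-filter⁺ (T? ∘ separating) g∈ g-separates)
    in ≤∞-trans (min∞-≤ weight∈)
                (fin≤fin (≤-reflexive (weightOf-cong m w (cong isS ∘ g≗f))))

  κDi-greatest-+∞ : ∀ {z} k → (∀ {f} → Separates E f s t → z ≤∞ fin (cutWeight m w f) +∞ k) →
                    z ≤∞ κDi m E w s t +∞ k
  κDi-greatest-+∞ k bound = min∞-greatest-+∞ _ k λ x∈ →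
    let f , f∈ , x≡     = ∈-map⁻ weight x∈
        _ , f-separates = ∈-filter⁻ (T? ∘ separating) {xs = labellings m} f∈
    in subst (λ x → _ ≤∞ x +∞ k) (sym x≡) (bound (isDiCut⇒Separates f-separates))

module _ {m : ℕ} (P : Fin m → Bool) (k : Fin m → Fin m → ℕ∞) where

  private
    pairsFrom : Fin m → List ℕ∞
    pairsFrom s = map (k s) (filterᵇ P (allFin m))

  minPairs-≤ : ∀ {s t} → T (P s) → T (P t) → minPairs m P k ≤∞ k s t
  minPairs-≤ {s} {t} Ps Pt = min∞-≤ (∈-concatMap⁺ pairsFrom (lose (∈P s Ps) (∈-map⁺ (k s) (∈P t Pt))))
    where
    ∈P : ∀ u → T (P u) → u ∈ filterᵇ P (allFin m)
    ∈P u = ∈-filter⁺ (T? ∘ P) (∈-allFin u)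

  minPairs-greatest-+∞ : ∀ {z} j → (∀ {s t} → T (P s) → T (P t) → z ≤∞ k s t +∞ j) →
                         z ≤∞ minPairs m P k +∞ j
  minPairs-greatest-+∞ j bound = min∞-greatest-+∞ _ j λ x∈ →
    let s , s∈ , x∈s = find (∈-concatMap⁻ pairsFrom {xs = filterᵇ P (allFin m)} x∈)
        t , t∈ , x≡  = ∈-map⁻ (k s) x∈s
        _ , Ps = ∈-filter⁻ (T? ∘ P) {xs = allFin m} s∈
        _ , Pt = ∈-filter⁻ (T? ∘ P) {xs = allFin m} t∈
    in subst (λ x → _ ≤∞ x +∞ j) (sym x≡) (bound Ps Pt)

module _ {m : ℕ} (E : Fin m → Fin m → Bool) (w : Fin m → ℕ) (P : Fin m → Bool) where

  minCut-≤ : ∀ {s t f} → T (P s) → T (P t) → Separates E f s t →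
             minPairs m P (κDi m E w) ≤∞ fin (cutWeight m w f)
  minCut-≤ Ps Pt sep = ≤∞-trans (minPairs-≤ P (κDi m E w) Ps Pt) (κDi-≤ E w sep)

  minCut-greatest-+∞ : ∀ {z} k →
    (∀ {s t f} → T (P s) → T (P t) → Separates E f s t → z ≤∞ fin (cutWeight m w f + k)) →
    z ≤∞ minPairs m P (κDi m E w) +∞ k
  minCut-greatest-+∞ k bound =
    minPairs-greatest-+∞ P (κDi m E w) k λ Ps Pt → κDi-greatest-+∞ E w k (bound Ps Pt)

  minCut-greatest : ∀ {z} →
    (∀ {s t f} → T (P s) → T (P t) → Separates E f s t → z ≤∞ fin (cutWeight m w f)) →
    z ≤∞ minPairs m P (κDi m E w)
  minCut-greatest bound =
    subst (_ ≤∞_) (+∞-identityʳ _) (minCut-greatest-+∞ 0 λ Ps Pt sep →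
      subst (λ c → _ ≤∞ fin c) (sym (+-identityʳ _)) (bound Ps Pt sep))

-- isUnCut m A unfolds to isDiCut m (undirected A), so κUn m A is κDi m (undirected A).
undirected : ∀ {m} → (Fin m → Fin m → Bool) → Fin m → Fin m → Bool
undirected A u v = A u v ∨ A v u

undirected-sym : ∀ {m} (A : Fin m → Fin m → Bool) {u v} → T (undirected A u v) → T (undirected A v u)
undirected-sym A {u} {v} = subst T (∨-comm (A u v) (A v u))

T-==⇒≡ : ∀ {m} {u v : Fin m} → T (u == v) → u ≡ v
T-==⇒≡ {u = u} {v} t with u ≟ v
... | yes u≡v = u≡v

T-==-refl : ∀ {m} (u : Fin m) → T (u == u)
T-==-refl u rewrite dec-true (u ≟ u) refl = _

outLabel : Part → Part
outLabel Lp = Lp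
outLabel _  = Sp

inLabel : Part → Part
inLabel Rp = Rp
inLabel _  = Sp

outLabel-Lp⁻ : ∀ {p} → outLabel p ≡ Lp → p ≡ Lp
outLabel-Lp⁻ {Lp} _ = refl

inLabel-Rp⁻ : ∀ {p} → inLabel p ≡ Rp → p ≡ Rp
inLabel-Rp⁻ {Rp} _ = refl

outLabel≢Rp : ∀ p → outLabel p ≢ Rp
outLabel≢Rp Lp ()
outLabel≢Rp Sp ()
outLabel≢Rp Rp ()

inLabel≢Lp : ∀ p → inLabel p ≢ Lp
inLabel≢Lp Lp ()
inLabel≢Lp Sp ()
inLabel≢Lp Rp ()

sWeight-outLabel-inLabel : ∀ p a → sWeight (outLabel p) a + sWeight (inLabel p) a ≡ sWeight p a + a
sWeight-outLabel-inLabel Lp a = refl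
sWeight-outLabel-inLabel Sp a = refl
sWeight-outLabel-inLabel Rp a = +-identityʳ a

merge : Part → Part → Part
merge Lp _  = Lp
merge _  Rp = Rp
merge _  _  = Sp

merge-Lp⁻ : ∀ p q → merge p q ≡ Lp → p ≡ Lp
merge-Lp⁻ Lp _  _ = refl
merge-Lp⁻ Sp Lp ()
merge-Lp⁻ Sp Sp ()
merge-Lp⁻ Sp Rp ()
merge-Lp⁻ Rp Lp ()
merge-Lp⁻ Rp Sp ()
merge-Lp⁻ Rp Rp ()

merge-Rp⁻ : ∀ p q → merge p q ≡ Rp → q ≡ Rp
merge-Rp⁻ Lp _  ()
merge-Rp⁻ Sp Lp ()
merge-Rp⁻ Sp Sp ()
merge-Rp⁻ Sp Rp _ = refl
merge-Rp⁻ Rp Lp ()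
merge-Rp⁻ Rp Sp ()
merge-Rp⁻ Rp Rp _ = refl

merge-Rp : ∀ p → p ≢ Lp → merge p Rp ≡ Rp
merge-Rp Lp p≢L = ⊥-elim (p≢L refl)
merge-Rp Sp _   = refl
merge-Rp Rp _   = refl

sWeight-merge : ∀ p q a → p ≢ Rp → q ≢ Lp → (p ≡ Lp → q ≢ Rp) →
                sWeight p a + sWeight q a ≡ sWeight (merge p q) a + a
sWeight-merge Lp Sp a _ _ _ = refl
sWeight-merge Sp Sp a _ _ _ = refl
sWeight-merge Sp Rp a _ _ _ = +-identityʳ a
sWeight-merge Rp _  a p≢R _ _ = ⊥-elim (p≢R refl)
sWeight-merge _  Lp a _ q≢L _ = ⊥-elim (q≢L refl)
sWeight-merge Lp Rp a _ _ ¬LR = ⊥-elim (¬LR refl refl)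

module SplitGraph {n : ℕ} (E : Fin n → Fin n → Bool) (w : Fin n → ℕ) where

  E' : Fin (n + n) → Fin (n + n) → Bool
  E' = undirected (splitAdj n E)

  w' : Fin (n + n) → ℕ
  w' = splitWeight n w

  data Copy : Fin (n + n) → Set where
    out-copy : ∀ u → Copy (vOut {n} u)
    in-copy  : ∀ u → Copy (vIn {n} u)

  copy : ∀ x → Copy x
  copy x with splitAt n x in eq
  ... | inj₁ u = subst Copy (splitAt⁻¹-↑ˡ eq) (out-copy u)
  ... | inj₂ u = subst Copy (splitAt⁻¹-↑ʳ {n} {n} eq) (in-copy u)

  outs-close : ∀ u v → vOut u ≡ vOut v ⊎ T (E' (vOut u) (vOut v))
  outs-close u v with u ≟ v
  ... | yes u≡v = inj₁ (cong vOut u≡v)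
  ... | no  u≢v = inj₂ (Equivalence.from T-∨ (inj₁ clique))
    where
    clique : T (splitAdj n E (vOut u) (vOut v))
    clique rewrite splitAt-↑ˡ n u n | splitAt-↑ˡ n v n | dec-false (u ≟ v) u≢v = _

  ins-close : ∀ u v → vIn u ≡ vIn v ⊎ T (E' (vIn u) (vIn v))
  ins-close u v with u ≟ v
  ... | yes u≡v = inj₁ (cong vIn u≡v)
  ... | no  u≢v = inj₂ (Equivalence.from T-∨ (inj₁ clique))
    where
    clique : T (splitAdj n E (vIn u) (vIn v))
    clique rewrite splitAt-↑ʳ n n u | splitAt-↑ʳ n n v | dec-false (u ≟ v) u≢v = _

  T-splitAdj-out-in : ∀ u v → T (splitAdj n E (vOut u) (vIn v)) ⇔ (u ≡ v ⊎ T (E u v))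
  T-splitAdj-out-in u v rewrite splitAt-↑ˡ n u n | splitAt-↑ʳ n n v =
    mk⇔ (Sum.map₁ T-==⇒≡ ∘ Equivalence.to T-∨) (Equivalence.from T-∨ ∘ Sum.map₁ λ { refl → T-==-refl u })

  T-splitAdj-in-out : ∀ u v → T (splitAdj n E (vIn v) (vOut u)) ⇔ (u ≡ v ⊎ T (E u v))
  T-splitAdj-in-out u v rewrite splitAt-↑ʳ n n v | splitAt-↑ˡ n u n =
    mk⇔ (Sum.map₁ (sym ∘ T-==⇒≡) ∘ Equivalence.to T-∨) (Equivalence.from T-∨ ∘ Sum.map₁ λ { refl → T-==-refl u })

  E'-out-in : ∀ u v → u ≡ v ⊎ T (E u v) → T (E' (vOut u) (vIn v))
  E'-out-in u v = Equivalence.from T-∨ ∘ inj₁ ∘ Equivalence.from (T-splitAdj-out-in u v)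

  E'-out-in⁻ : ∀ u v → T (E' (vOut u) (vIn v)) → u ≡ v ⊎ T (E u v)
  E'-out-in⁻ u v =
    [ Equivalence.to (T-splitAdj-out-in u v) , Equivalence.to (T-splitAdj-in-out u v) ]′ ∘ Equivalence.to T-∨

  cutWeight-split : ∀ {g : Fin (n + n) → Part} {f : Fin n → Part} →
    (∀ u → sWeight (g (vOut u)) (w u) + sWeight (g (vIn u)) (w u) ≡ sWeight (f u) (w u) + w u) →
    cutWeight (n + n) w' g ≡ cutWeight n w f + totalWeight n w
  cutWeight-split {g} {f} per-vertex = begin
    cutWeight (n + n) w' g
      ≡⟨ cutWeight-∑ (n + n) w' g ⟩
    ∑[ x < n + n ] sWeight (g x) (w' x)
      ≡⟨ ∑-↑ n n _ ⟩
    ∑[ u < n ] sWeight (g (vOut u)) (w' (vOut u)) + ∑[ u < n ] sWeight (g (vIn u)) (w' (vIn u))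
      ≡⟨ cong₂ _+_ (sum-cong-≗ λ u → cong (sWeight _) (lookup-++ˡ w w u))
                   (sum-cong-≗ λ u → cong (sWeight _) (lookup-++ʳ w w u)) ⟩
    ∑[ u < n ] sWeight (g (vOut u)) (w u) + ∑[ u < n ] sWeight (g (vIn u)) (w u)
      ≡⟨ ∑-distrib-+ (λ u → sWeight (g (vOut u)) (w u)) (λ u → sWeight (g (vIn u)) (w u)) ⟨
    ∑[ u < n ] (sWeight (g (vOut u)) (w u) + sWeight (g (vIn u)) (w u))
      ≡⟨ sum-cong-≗ per-vertex ⟩
    ∑[ u < n ] (sWeight (f u) (w u) + w u)
      ≡⟨ ∑-distrib-+ (λ u → sWeight (f u) (w u)) w ⟩
    ∑[ u < n ] sWeight (f u) (w u) + ∑[ u < n ] w u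
      ≡⟨ cong₂ _+_ (cutWeight-∑ n w f) (totalWeight-∑ n w) ⟨
    cutWeight n w f + totalWeight n w
      ∎
    where open ≡-Reasoning

  splitLabelling : (Fin n → Part) → Fin (n + n) → Part
  splitLabelling f = (outLabel ∘ f) ++ (inLabel ∘ f)

  splitLabelling-out : ∀ f u → splitLabelling f (vOut u) ≡ outLabel (f u)
  splitLabelling-out f = lookup-++ˡ (outLabel ∘ f) (inLabel ∘ f)

  splitLabelling-in : ∀ f u → splitLabelling f (vIn u) ≡ inLabel (f u)
  splitLabelling-in f = lookup-++ʳ (outLabel ∘ f) (inLabel ∘ f)

  splitLabelling-separates : ∀ {f s t} → Separates E f s t →
                             Separates E' (splitLabelling f) (vOut s) (vIn t)
  splitLabelling-separates {f} {s} {t} sep = record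
    { source  = trans (splitLabelling-out f s) (cong outLabel source)
    ; sink    = trans (splitLabelling-in f t) (cong inLabel sink)
    ; no-edge = no-L-R-edge
    }
    where
    open Separates sep
    no-L-R-edge : ∀ {x y} → splitLabelling f x ≡ Lp → splitLabelling f y ≡ Rp → ¬ T (E' x y)
    no-L-R-edge {x} {y} x∈L y∈R e with copy x | copy y
    ... | in-copy u  | _          = inLabel≢Lp (f u) (trans (sym (splitLabelling-in f u)) x∈L)
    ... | out-copy u | out-copy v = outLabel≢Rp (f v) (trans (sym (splitLabelling-out f v)) y∈R)
    ... | out-copy u | in-copy v  =
      apart (outLabel-Lp⁻ (trans (sym (splitLabelling-out f u)) x∈L))
            (inLabel-Rp⁻ (trans (sym (splitLabelling-in f v)) y∈R))
            (E'-out-in⁻ u v e)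

  cutWeight-splitLabelling : ∀ f → cutWeight (n + n) w' (splitLabelling f) ≡ cutWeight n w f + totalWeight n w
  cutWeight-splitLabelling f = cutWeight-split λ u → begin
    sWeight (splitLabelling f (vOut u)) (w u) + sWeight (splitLabelling f (vIn u)) (w u)
      ≡⟨ cong₂ (λ p q → sWeight p (w u) + sWeight q (w u)) (splitLabelling-out f u) (splitLabelling-in f u) ⟩
    sWeight (outLabel (f u)) (w u) + sWeight (inLabel (f u)) (w u)
      ≡⟨ sWeight-outLabel-inLabel (f u) (w u) ⟩
    sWeight (f u) (w u) + w u
      ∎
    where open ≡-Reasoning

  mergeLabelling : (Fin (n + n) → Part) → Fin n → Part
  mergeLabelling g u = merge (g (vOut u)) (g (vIn u))

  module OutInCut {g : Fin (n + n) → Part} {a b : Fin n} (sep : Separates E' g (vOut a) (vIn b)) where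
    open Separates sep

    out∉R : ∀ u → g (vOut u) ≢ Rp
    out∉R u u∈R = apart source u∈R (outs-close a u)

    in∉L : ∀ u → g (vIn u) ≢ Lp
    in∉L u u∈L = apart u∈L sink (ins-close u b)

    out∈L⇒in∉R : ∀ u → g (vOut u) ≡ Lp → g (vIn u) ≢ Rp
    out∈L⇒in∉R u out∈L in∈R = no-edge out∈L in∈R (E'-out-in u u (inj₁ refl))

    mergeLabelling-separates : Separates E (mergeLabelling g) a b
    mergeLabelling-separates = record
      { source  = cong (λ p → merge p (g (vIn a))) source
      ; sink    = trans (cong (merge (g (vOut b))) sink)
                        (merge-Rp (g (vOut b)) λ out∈L → out∈L⇒in∉R b out∈L sink)
      ; no-edge = λ {u} {v} u∈L v∈R e →
                  no-edge (merge-Lp⁻ _ _ u∈L) (merge-Rp⁻ _ _ v∈R) (E'-out-in u v (inj₂ e))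
      }

    cutWeight-mergeLabelling : cutWeight (n + n) w' g ≡ cutWeight n w (mergeLabelling g) + totalWeight n w
    cutWeight-mergeLabelling =
      cutWeight-split λ u → sWeight-merge _ _ (w u) (out∉R u) (in∉L u) (out∈L⇒in∉R u)

  module _ (P : Fin n → Bool) where

    P' : Fin (n + n) → Bool
    P' = splitTerm n P

    P'-out : ∀ u → P' (vOut u) ≡ P u
    P'-out = lookup-++ˡ P P

    P'-in : ∀ u → P' (vIn u) ≡ P u
    P'-in = lookup-++ʳ P P

    minCut-split-≤ : minPairs (n + n) P' (κUn (n + n) (splitAdj n E) w')
                     ≤∞ minPairs n P (κDi n E w) +∞ totalWeight n w
    minCut-split-≤ = minCut-greatest-+∞ E w P _ λ {s} {t} {f} Ps Pt sep →
      subst (λ c → _ ≤∞ fin c) (cutWeight-splitLabelling f)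
        (minCut-≤ E' w' P' (subst T (sym (P'-out s)) Ps) (subst T (sym (P'-in t)) Pt)
                  (splitLabelling-separates sep))

    out-in-cut-bound : ∀ {g a b} → T (P a) → T (P b) → Separates E' g (vOut a) (vIn b) →
                       minPairs n P (κDi n E w) +∞ totalWeight n w ≤∞ fin (cutWeight (n + n) w' g)
    out-in-cut-bound Pa Pb sep =
      subst (λ c → _ ≤∞ fin c) (sym cutWeight-mergeLabelling)
        (+∞-monoˡ-≤∞ (totalWeight n w) (minCut-≤ E w P Pa Pb mergeLabelling-separates))
      where open OutInCut sep

    terminal-cut-bound : ∀ {g s' t'} → T (P' s') → T (P' t') → Separates E' g s' t' →
                         minPairs n P (κDi n E w) +∞ totalWeight n w ≤∞ fin (cutWeight (n + n) w' g)
    terminal-cut-bound {g} {s'} {t'} Ps' Pt' sep with copy s' | copy t'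
    ... | out-copy a | out-copy b = ⊥-elim (Separates.ends-apart sep (outs-close a b))
    ... | in-copy a  | in-copy b  = ⊥-elim (Separates.ends-apart sep (ins-close a b))
    ... | out-copy a | in-copy b  = out-in-cut-bound (subst T (P'-out a) Ps') (subst T (P'-in b) Pt') sep
    ... | in-copy a  | out-copy b =
      subst (λ c → _ ≤∞ fin c) (cutWeight-mirror (n + n) w' g)
        (out-in-cut-bound (subst T (P'-out b) Pt') (subst T (P'-in a) Ps')
                          (Separates-mirror (undirected-sym (splitAdj n E)) sep))

    minCut-merge-≤ : minPairs n P (κDi n E w) +∞ totalWeight n w
                     ≤∞ minPairs (n + n) P' (κUn (n + n) (splitAdj n E) w')
    minCut-merge-≤ = minCut-greatest E' w' P' terminal-cut-bound

corollary3p8 : (n : ℕ) (E : Fin n → Fin n → Bool) (w : Fin n → ℕ)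
    → (∀ v → 0 < w v) → (T : Fin n → Bool)
    → minPairs n T (κDi n E w) +∞ totalWeight n w
      ≡ minPairs (n + n) (splitTerm n T) (κUn (n + n) (splitAdj n E) (splitWeight n w))
corollary3p8 n E w _ P = ≤∞-antisym (minCut-merge-≤ P) (minCut-split-≤ P)
  where open SplitGraph E w
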